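{- If $\Gamma$ is an inner ultrahomogeneous group, then $\Gamma$ is not a direct product $G_1\times G_2$ of two nontrivial groups.
   Context: Conjugation is written $g^h=h^{ -1}gh$. A finite partial automorphism of a group $G$ is an isomorphism between two finitely generated subgroups of $G$. A group $\Gamma$ is inner ultrahomogeneous if for every finite partial automorphism $p$ of $\Gamma$ there is some $g\in\Gamma$ such that $a^g=p(a)$ for all $a\in\operatorname{dom}p$. -}

module Defs where

open import Level using (Level; _⊔_; 0ℓ)
open import Data.Nat using (ℕ)
open import Data.Fin using (Fin)
open import Data.Product using (Σ; Σ-syntax; ∃; ∃-syntax; _,_; proj₁; proj₂)
open import Relation.Nullary using (¬_)
open import Algebra.Bundles using (Group; RawGroup)
open import Algebra.Structures using (IsGroup)
import Algebra.Morphism.Structures as MS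
import Algebra.Construct.DirectProduct as DP

data Word (n : ℕ) : Set where
  gen  : Fin n → Word n
  unit : Word n
  _·_  : Word n → Word n → Word n
  inv  : Word n → Word n

module _ {c ℓ : Level} (G : Group c ℓ) where
  open Group G

  eval : {n : ℕ} → (Fin n → Carrier) → Word n → Carrier
  eval a (gen i)  = a i
  eval a unit     = ε
  eval a (u · v)  = eval a u ∙ eval a v
  eval a (inv u)  = eval a u ⁻¹

  InSpan : {n : ℕ} → (Fin n → Carrier) → Carrier → Set ℓ
  InSpan a g = ∃[ w ] (eval a w ≈ g)

  span : {n : ℕ} → (Fin n → Carrier) → Group (c ⊔ ℓ) ℓ
  span {n} a = record
    { Carrier = S
    ; _≈_ = λ x y → proj₁ x ≈ proj₁ y
    ; _∙_ = mul
    ; ε = (ε , unit , refl)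
    ; _⁻¹ = inv'
    ; isGroup = record
      { isMonoid = record
        { isSemigroup = record
          { isMagma = record
            { isEquivalence = record { refl = refl ; sym = sym ; trans = trans }
            ; ∙-cong = ∙-cong }
          ; assoc = λ x y z → assoc (proj₁ x) (proj₁ y) (proj₁ z) }
        ; identity = (λ x → identityˡ (proj₁ x)) , (λ x → identityʳ (proj₁ x)) }
      ; inverse = (λ x → inverseˡ (proj₁ x)) , (λ x → inverseʳ (proj₁ x))
      ; ⁻¹-cong = ⁻¹-cong }
    }
    where
    S = Σ Carrier (InSpan a)
    mul : S → S → S
    mul (x , u , p) (y , v , q) = (x ∙ y , u · v , ∙-cong p q)
    inv' : S → S
    inv' (x , u , p) = (x ⁻¹ , inv u , ⁻¹-cong p)

  record FinitePartialAut : Set (c ⊔ ℓ) where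
    field
      n m : ℕ
      a   : Fin n → Carrier
      b   : Fin m → Carrier
      p   : Group.Carrier (span a) → Group.Carrier (span b)
      isIso : MS.GroupMorphisms.IsGroupIsomorphism
                (Group.rawGroup (span a)) (Group.rawGroup (span b)) p

  _^_ : Carrier → Carrier → Carrier
  g ^ h = (h ⁻¹ ∙ g) ∙ h

  InnerUltrahomogeneous : Set (c ⊔ ℓ)
  InnerUltrahomogeneous =
    (π : FinitePartialAut) → let open FinitePartialAut π in
      ∃[ g ] ((x : Group.Carrier (span a)) → (proj₁ x ^ g) ≈ proj₁ (p x))

  Nontrivial : Set (c ⊔ ℓ)
  Nontrivial = ∃[ x ] (¬ (x ≈ ε))

IsoToProduct : {c ℓ c₁ ℓ₁ c₂ ℓ₂ : Level} →
  Group c ℓ → Group c₁ ℓ₁ → Group c₂ ℓ₂ → Set (c ⊔ ℓ ⊔ c₁ ⊔ ℓ₁ ⊔ c₂ ⊔ ℓ₂)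
IsoToProduct Γ G₁ G₂ =
  Σ[ φ ∈ (Group.Carrier Γ → Group.Carrier (DP.group G₁ G₂)) ]
    MS.GroupMorphisms.IsGroupIsomorphism
      (Group.rawGroup Γ) (Group.rawGroup (DP.group G₁ G₂)) φ

{-# OPTIONS --safe #-}

-- In an inner ultrahomogeneous group, elements u and v of the same order are conjugate: the
-- isomorphism ⟨u⟩ ≅ ⟨v⟩ sending u to v is a finite partial automorphism. In G₁ × G₂ conjugation
-- acts coordinatewise, so for t ≠ 1 the elements (s , 1) and (s , t) are never conjugate, i.e. the
-- order of t never divides that of s (infinite order counting as 0). Every a is conjugate to a⁻¹,
-- say by h; if G₁ had no involution, then for a ≠ 1 this h would have infinite order, which the
-- order of any t ∈ G₂ divides. So G₁, and symmetrically G₂, has an involution, and involutions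
-- s ∈ G₁, t ∈ G₂ contradict the same fact.
module Submission where

open import Defs hiding (_^_)
open import Level using (Level; _⊔_)
open import Relation.Nullary using (¬_)
open import Algebra.Bundles using (Group)

import Algebra.Construct.DirectProduct as DirectProduct
open import Algebra.Morphism.Structures using (module GroupMorphisms)
open import Data.Empty using (⊥-elim)
import Data.Fin as Fin
open import Data.Nat using (ℕ; zero; suc; _+_; _<_; z<s)
open import Data.Nat.Induction using (<-wellFounded)
open import Data.Nat.Properties using (+-comm; +-suc; ≤-total; m≤n⇒∃[o]m+o≡n; m<m+n; 1+n≢0)
open import Data.Product using (∃; ∃-syntax; _,_; proj₁; proj₂; swap)
open import Data.Sum using (_⊎_; inj₁; inj₂)
open import Function using (const; _⇔_; mk⇔; Equivalence)
open import Function.Construct.Composition using (_⇔-∘_)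
open import Function.Construct.Symmetry using (⇔-sym)
open import Induction.WellFounded using (Acc; acc)
open import Relation.Binary.PropositionalEquality as ≡ using (_≡_)

private
  variable
    c ℓ c′ ℓ′ : Level

positiveOccurrences negativeOccurrences : ∀ {k} → Word k → ℕ
positiveOccurrences (gen _) = 1
positiveOccurrences unit = 0
positiveOccurrences (u · v) = positiveOccurrences u + positiveOccurrences v
positiveOccurrences (inv u) = negativeOccurrences u
negativeOccurrences (gen _) = 0
negativeOccurrences unit = 0
negativeOccurrences (u · v) = negativeOccurrences u + negativeOccurrences v
negativeOccurrences (inv u) = positiveOccurrences u

even-or-odd : ∀ n → ∃[ k ] (n ≡ k + k ⊎ n ≡ suc (k + k))
even-or-odd zero = 0 , inj₁ ≡.refl
even-or-odd (suc n) with even-or-odd n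
... | k , inj₁ ≡.refl = k , inj₂ ≡.refl
... | k , inj₂ ≡.refl = suc k , inj₁ (≡.cong suc (≡.sym (+-suc k k)))

module Elements (G : Group c ℓ) where
  open Group G public
  open import Algebra.Properties.Group G public
  open import Algebra.Properties.Semigroup semigroup using (uv≈wx⇒yu∙vz≈yw∙xz; uv≈w⇒xu∙vy≈x∙wy)
  -- n × x is the power xⁿ, and _^_ is conjugation.
  open import Algebra.Properties.Monoid.Mult monoid public using (_×_; ×-congʳ; ×-homo-+)
  open import Relation.Binary.Reasoning.Setoid setoid

  infixl 8 _^_
  _^_ : Carrier → Carrier → Carrier
  _^_ = Defs._^_ G

  x∙y≈y∙x⇒x⁻¹∙y≈y∙x⁻¹ : ∀ {x y} → x ∙ y ≈ y ∙ x → x ⁻¹ ∙ y ≈ y ∙ x ⁻¹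
  x∙y≈y∙x⇒x⁻¹∙y≈y∙x⁻¹ {x} {y} xy≈yx = begin
    x ⁻¹ ∙ y                  ≈⟨ ∙-congˡ (identityʳ y) ⟨
    x ⁻¹ ∙ (y ∙ ε)            ≈⟨ ∙-congˡ (∙-congˡ (inverseʳ x)) ⟨
    x ⁻¹ ∙ (y ∙ (x ∙ x ⁻¹))   ≈⟨ ∙-congˡ (assoc y x (x ⁻¹)) ⟨
    x ⁻¹ ∙ ((y ∙ x) ∙ x ⁻¹)   ≈⟨ ∙-congˡ (∙-congʳ xy≈yx) ⟨
    x ⁻¹ ∙ ((x ∙ y) ∙ x ⁻¹)   ≈⟨ ∙-congˡ (assoc x y (x ⁻¹)) ⟩
    x ⁻¹ ∙ (x ∙ (y ∙ x ⁻¹))   ≈⟨ assoc (x ⁻¹) x (y ∙ x ⁻¹) ⟨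
    (x ⁻¹ ∙ x) ∙ (y ∙ x ⁻¹)   ≈⟨ ∙-congʳ (inverseˡ x) ⟩
    ε ∙ (y ∙ x ⁻¹)            ≈⟨ identityˡ (y ∙ x ⁻¹) ⟩
    y ∙ x ⁻¹                  ∎

  ×-comm : ∀ x m n → m × x ∙ n × x ≈ n × x ∙ m × x
  ×-comm x m n = begin
    m × x ∙ n × x  ≈⟨ ×-homo-+ x m n ⟨
    (m + n) × x    ≡⟨ ≡.cong (_× x) (+-comm m n) ⟩
    (n + m) × x    ≈⟨ ×-homo-+ x n m ⟩
    n × x ∙ m × x  ∎

  ×-ε : ∀ n → n × ε ≈ ε
  ×-ε zero = refl
  ×-ε (suc n) = trans (identityˡ (n × ε)) (×-ε n)

  x∙×≈×∙x : ∀ x n → x ∙ n × x ≈ n × x ∙ x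
  x∙×≈×∙x x n = begin
    x ∙ n × x      ≈⟨ ∙-congʳ (identityʳ x) ⟨
    1 × x ∙ n × x  ≈⟨ ×-comm x 1 n ⟩
    n × x ∙ 1 × x  ≈⟨ ∙-congˡ (identityʳ x) ⟩
    n × x ∙ x      ∎

  ×-⁻¹ : ∀ n x → n × (x ⁻¹) ≈ (n × x) ⁻¹
  ×-⁻¹ zero x = sym ε⁻¹≈ε
  ×-⁻¹ (suc n) x = inverseˡ-unique (suc n × (x ⁻¹)) (suc n × x) (begin
    (x ⁻¹ ∙ n × (x ⁻¹)) ∙ (x ∙ n × x)  ≈⟨ ∙-congˡ (x∙×≈×∙x x n) ⟩
    (x ⁻¹ ∙ n × (x ⁻¹)) ∙ (n × x ∙ x)  ≈⟨ uv≈w⇒xu∙vy≈x∙wy powers-cancel (x ⁻¹) x ⟩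
    x ⁻¹ ∙ (ε ∙ x)                     ≈⟨ ∙-congˡ (identityˡ x) ⟩
    x ⁻¹ ∙ x                           ≈⟨ inverseˡ x ⟩
    ε                                  ∎)
    where
    powers-cancel : n × (x ⁻¹) ∙ n × x ≈ ε
    powers-cancel = trans (∙-congʳ (×-⁻¹ n x)) (inverseˡ (n × x))

  ×-cancelˡ : ∀ x m n → (m + n) × x ≈ m × x → n × x ≈ ε
  ×-cancelˡ x m n e = identityʳ-unique (m × x) (n × x) (trans (sym (×-homo-+ x m n)) e)

  ×-absorbʳ : ∀ x m n → n × x ≈ ε → (m + n) × x ≈ m × x
  ×-absorbʳ x m n e = trans (×-homo-+ x m n) (trans (∙-congˡ e) (identityʳ (m × x)))

  ×//×-∙ : ∀ x a b c d → (a × x // b × x) ∙ (c × x // d × x) ≈ (a + c) × x // (b + d) × x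
  ×//×-∙ x a b c d = begin
    (a × x ∙ (b × x) ⁻¹) ∙ (c × x ∙ (d × x) ⁻¹)
      ≈⟨ uv≈wx⇒yu∙vz≈yw∙xz (x∙y≈y∙x⇒x⁻¹∙y≈y∙x⁻¹ (×-comm x b c)) (a × x) ((d × x) ⁻¹) ⟩
    (a × x ∙ c × x) ∙ ((b × x) ⁻¹ ∙ (d × x) ⁻¹)  ≈⟨ ∙-congˡ (⁻¹-anti-homo-∙ (d × x) (b × x)) ⟨
    (a × x ∙ c × x) ∙ (d × x ∙ b × x) ⁻¹         ≈⟨ ∙-congˡ (⁻¹-cong (×-comm x d b)) ⟩
    (a × x ∙ c × x) ∙ (b × x ∙ d × x) ⁻¹         ≈⟨ ∙-cong (×-homo-+ x a c) (⁻¹-cong (×-homo-+ x b d)) ⟨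
    (a + c) × x ∙ ((b + d) × x) ⁻¹               ∎

  eval-const : ∀ {k} x (w : Word k) →
    eval G (const x) w ≈ positiveOccurrences w × x // negativeOccurrences w × x
  eval-const x (gen _) = begin
    x               ≈⟨ identityʳ x ⟨
    x ∙ ε           ≈⟨ ∙-congˡ ε⁻¹≈ε ⟨
    x ∙ ε ⁻¹        ≈⟨ ∙-congʳ (identityʳ x) ⟨
    (x ∙ ε) ∙ ε ⁻¹  ∎
  eval-const x unit = sym (inverseʳ ε)
  eval-const x (u · v) = trans (∙-cong (eval-const x u) (eval-const x v))
    (×//×-∙ x (positiveOccurrences u) (negativeOccurrences u) (positiveOccurrences v) (negativeOccurrences v))
  eval-const x (inv u) = trans (⁻¹-cong (eval-const x u)) (⁻¹-anti-homo-// _ _)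

  ^-cong : ∀ {x y g h} → x ≈ y → g ≈ h → x ^ g ≈ y ^ h
  ^-cong x≈y g≈h = ∙-cong (∙-cong (⁻¹-cong g≈h) x≈y) g≈h

  x^ε≈x : ∀ x → x ^ ε ≈ x
  x^ε≈x x = trans (identityʳ _) (trans (∙-congʳ ε⁻¹≈ε) (identityˡ x))

  ε^g≈ε : ∀ g → ε ^ g ≈ ε
  ε^g≈ε g = trans (∙-congʳ (identityʳ (g ⁻¹))) (inverseˡ g)

  x^gh≈[x^g]^h : ∀ x g h → x ^ (g ∙ h) ≈ (x ^ g) ^ h
  x^gh≈[x^g]^h x g h = begin
    ((g ∙ h) ⁻¹ ∙ x) ∙ (g ∙ h)        ≈⟨ ∙-congʳ (∙-congʳ (⁻¹-anti-homo-∙ g h)) ⟩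
    ((h ⁻¹ ∙ g ⁻¹) ∙ x) ∙ (g ∙ h)     ≈⟨ assoc _ g h ⟨
    (((h ⁻¹ ∙ g ⁻¹) ∙ x) ∙ g) ∙ h     ≈⟨ ∙-congʳ (∙-congʳ (assoc (h ⁻¹) (g ⁻¹) x)) ⟩
    ((h ⁻¹ ∙ (g ⁻¹ ∙ x)) ∙ g) ∙ h     ≈⟨ ∙-congʳ (assoc (h ⁻¹) (g ⁻¹ ∙ x) g) ⟩
    (h ⁻¹ ∙ ((g ⁻¹ ∙ x) ∙ g)) ∙ h     ∎

  x⁻¹^g≈[x^g]⁻¹ : ∀ x g → x ⁻¹ ^ g ≈ (x ^ g) ⁻¹
  x⁻¹^g≈[x^g]⁻¹ x g = begin
    (g ⁻¹ ∙ x ⁻¹) ∙ g             ≈⟨ assoc (g ⁻¹) (x ⁻¹) g ⟩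
    g ⁻¹ ∙ (x ⁻¹ ∙ g)             ≈⟨ ∙-congˡ (∙-congˡ (⁻¹-involutive g)) ⟨
    g ⁻¹ ∙ (x ⁻¹ ∙ g ⁻¹ ⁻¹)       ≈⟨ ∙-congˡ (⁻¹-anti-homo-∙ (g ⁻¹) x) ⟨
    g ⁻¹ ∙ (g ⁻¹ ∙ x) ⁻¹          ≈⟨ ⁻¹-anti-homo-∙ (g ⁻¹ ∙ x) g ⟨
    ((g ⁻¹ ∙ x) ∙ g) ⁻¹           ∎

  record IsInvolution (x : Carrier) : Set ℓ where
    field
      square≈ε : x ∙ x ≈ ε
      nontrivial : ¬ x ≈ ε

  HasInvolution : Set (c ⊔ ℓ)
  HasInvolution = ∃ IsInvolution

  square≈ε⇒even×≈ε : ∀ {x} → x ∙ x ≈ ε → ∀ k → (k + k) × x ≈ ε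
  square≈ε⇒even×≈ε x²≈ε zero = refl
  square≈ε⇒even×≈ε {x} x²≈ε (suc k) = begin
    (suc k + suc k) × x      ≡⟨ ≡.cong (λ n → suc n × x) (+-suc k k) ⟩
    x ∙ (x ∙ (k + k) × x)    ≈⟨ assoc x x ((k + k) × x) ⟨
    (x ∙ x) ∙ (k + k) × x    ≈⟨ ∙-cong x²≈ε (square≈ε⇒even×≈ε x²≈ε k) ⟩
    ε ∙ ε                    ≈⟨ identityˡ ε ⟩
    ε                        ∎

  square≈ε⇒odd×≈x : ∀ {x} → x ∙ x ≈ ε → ∀ k → suc (k + k) × x ≈ x
  square≈ε⇒odd×≈x {x} x²≈ε k = trans (∙-congˡ (square≈ε⇒even×≈ε x²≈ε k)) (identityʳ x)

  module _ {a h : Carrier} (a^h≈a⁻¹ : a ^ h ≈ a ⁻¹) where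

    a^hg≈[a^g]⁻¹ : ∀ g → a ^ (h ∙ g) ≈ (a ^ g) ⁻¹
    a^hg≈[a^g]⁻¹ g = trans (x^gh≈[x^g]^h a h g) (trans (^-cong a^h≈a⁻¹ refl) (x⁻¹^g≈[x^g]⁻¹ a g))

    a^even≈a : ∀ k → a ^ ((k + k) × h) ≈ a
    a^odd≈a⁻¹ : ∀ k → a ^ (suc (k + k) × h) ≈ a ⁻¹

    a^even≈a zero = x^ε≈x a
    a^even≈a (suc k) = begin
      a ^ ((suc k + suc k) × h)    ≡⟨ ≡.cong (λ n → a ^ (suc n × h)) (+-suc k k) ⟩
      a ^ (h ∙ suc (k + k) × h)    ≈⟨ a^hg≈[a^g]⁻¹ (suc (k + k) × h) ⟩
      (a ^ (suc (k + k) × h)) ⁻¹   ≈⟨ ⁻¹-cong (a^odd≈a⁻¹ k) ⟩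
      a ⁻¹ ⁻¹                      ≈⟨ ⁻¹-involutive a ⟩
      a                            ∎
    a^odd≈a⁻¹ k = trans (a^hg≈[a^g]⁻¹ ((k + k) × h)) (⁻¹-cong (a^even≈a k))

    -- Descent: if (k + k) × h ≈ ε with k > 0, then k × h is an involution unless k × h ≈ ε;
    -- an odd n with n × h ≈ ε would give a ≈ a ^ (n × h) ≈ a ⁻¹, making a an involution.
    inverter-infiniteOrder : ¬ HasInvolution → ¬ a ≈ ε → ∀ n → n × h ≈ ε → n ≡ 0
    inverter-infiniteOrder noInvolution a≉ε n = descend n (<-wellFounded n)
      where
      descend : ∀ n → Acc _<_ n → n × h ≈ ε → n ≡ 0
      descend n (acc smaller) hⁿ≈ε with even-or-odd n
      ... | zero , inj₁ ≡.refl = ≡.refl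
      ... | suc k , inj₁ ≡.refl = ⊥-elim (noInvolution (suc k × h , record
        { square≈ε = trans (sym (×-homo-+ h (suc k) (suc k))) hⁿ≈ε
        ; nontrivial = λ hᵏ≈ε → 1+n≢0 (descend (suc k) (smaller (m<m+n (suc k) z<s)) hᵏ≈ε)
        }))
      ... | k , inj₂ ≡.refl = ⊥-elim (noInvolution (a , record
        { square≈ε = trans (∙-congˡ a≈a⁻¹) (inverseʳ a)
        ; nontrivial = a≉ε
        }))
        where
        a≈a⁻¹ : a ≈ a ⁻¹
        a≈a⁻¹ = trans (sym (x^ε≈x a)) (trans (^-cong refl (sym hⁿ≈ε)) (a^odd≈a⁻¹ k))

  SameOrder : Carrier → Carrier → Set ℓ
  SameOrder u v = ∀ n → n × u ≈ ε ⇔ n × v ≈ ε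

  EqualOrderConjugate : Set (c ⊔ ℓ)
  EqualOrderConjugate = ∀ {u v} → SameOrder u v → ∃[ g ] u ^ g ≈ v

  sameOrder-⁻¹ : ∀ x → SameOrder x (x ⁻¹)
  sameOrder-⁻¹ x n = mk⇔
    (λ xⁿ≈ε → trans (×-⁻¹ n x) (trans (⁻¹-cong xⁿ≈ε) ε⁻¹≈ε))
    (λ x⁻ⁿ≈ε → ⁻¹-injective (trans (sym (×-⁻¹ n x)) (trans x⁻ⁿ≈ε (sym ε⁻¹≈ε))))

  conjugate-to-inverse : EqualOrderConjugate → ∀ x → ∃[ g ] x ^ g ≈ x ⁻¹
  conjugate-to-inverse conj x = conj (sameOrder-⁻¹ x)

module _ (G : Group c ℓ) (H : Group c′ ℓ′) where
  private
    module G = Elements G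
    module H = Elements H

  ×-+-transfer : ∀ {s t} → (∀ n → n G.× s G.≈ G.ε → n H.× t H.≈ H.ε) →
                 ∀ m k → (m + k) G.× s G.≈ m G.× s → (m + k) H.× t H.≈ m H.× t
  ×-+-transfer {s} {t} ann m k sᵐ⁺ᵏ≈sᵐ = H.×-absorbʳ t m k (ann k (G.×-cancelˡ s m k sᵐ⁺ᵏ≈sᵐ))

  ×-≈-transfer : ∀ {s t} → (∀ n → n G.× s G.≈ G.ε → n H.× t H.≈ H.ε) →
                 ∀ {m n} → m G.× s G.≈ n G.× s → m H.× t H.≈ n H.× t
  ×-≈-transfer ann {m} {n} sᵐ≈sⁿ with ≤-total m n
  ... | inj₁ m≤n with k , ≡.refl ← m≤n⇒∃[o]m+o≡n m≤n = H.sym (×-+-transfer ann m k (G.sym sᵐ≈sⁿ))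
  ... | inj₂ n≤m with k , ≡.refl ← m≤n⇒∃[o]m+o≡n n≤m = ×-+-transfer ann n k sᵐ≈sⁿ

  eval-const-≈-transfer : ∀ {s t} → (∀ n → n G.× s G.≈ G.ε → n H.× t H.≈ H.ε) →
    ∀ {k} {w w′ : Word k} →
    eval G (const s) w G.≈ eval G (const s) w′ → eval H (const t) w H.≈ eval H (const t) w′
  eval-const-≈-transfer {s} {t} ann {w = w} {w′} sʷ≈sʷ′ =
    H.x∙y⁻¹≈ε⇒x≈y _ _ (relation-transfer (w · inv w′) (G.x≈y⇒x∙y⁻¹≈ε sʷ≈sʷ′))
    where
    relation-transfer : ∀ r → eval G (const s) r G.≈ G.ε → eval H (const t) r H.≈ H.ε
    relation-transfer r sʳ≈ε =
      H.trans (H.eval-const t r) (H.x≈y⇒x∙y⁻¹≈ε (×-≈-transfer ann {positiveOccurrences r} {negativeOccurrences r}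
        (G.x∙y⁻¹≈ε⇒x≈y _ _ (G.trans (G.sym (G.eval-const s r)) sʳ≈ε))))

  involution-order-divides : ∀ {s t} → G.IsInvolution s → t H.∙ t H.≈ H.ε →
    ∀ n → n G.× s G.≈ G.ε → n H.× t H.≈ H.ε
  involution-order-divides s-involution t²≈ε n sⁿ≈ε with even-or-odd n
  ... | k , inj₁ ≡.refl = H.square≈ε⇒even×≈ε t²≈ε k
  ... | k , inj₂ ≡.refl = ⊥-elim (nontrivial (G.trans (G.sym (G.square≈ε⇒odd×≈x square≈ε k)) sⁿ≈ε))
    where open G.IsInvolution s-involution

  open GroupMorphisms G.rawGroup H.rawGroup using (IsGroupHomomorphism; IsGroupIsomorphism)

  module _ {f : G.Carrier → H.Carrier} (f-homo : IsGroupHomomorphism f) where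
    open IsGroupHomomorphism f-homo

    ×-homo : ∀ n x → f (n G.× x) H.≈ n H.× f x
    ×-homo zero x = ε-homo
    ×-homo (suc n) x = H.trans (homo x (n G.× x)) (H.∙-congˡ (×-homo n x))

    ^-homo : ∀ x g → f (x G.^ g) H.≈ f x H.^ f g
    ^-homo x g = H.trans (homo (g G.⁻¹ G.∙ x) g)
      (H.∙-congʳ (H.trans (homo (g G.⁻¹) x) (H.∙-congʳ (⁻¹-homo g))))

  module _ {φ : G.Carrier → H.Carrier} (φ-iso : IsGroupIsomorphism φ) where
    open IsGroupIsomorphism φ-iso
    open import Relation.Binary.Reasoning.Setoid H.setoid

    preimage : ∀ y → ∃[ x ] φ x H.≈ y
    preimage y = proj₁ (surjective y) , proj₂ (surjective y) G.refl

    annihilators-preserved : ∀ {x u} → φ x H.≈ u → ∀ n → n G.× x G.≈ G.ε ⇔ n H.× u H.≈ H.ε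
    annihilators-preserved {x} {u} φx≈u n = mk⇔
      (λ xⁿ≈ε → begin
        n H.× u       ≈⟨ H.×-congʳ n φx≈u ⟨
        n H.× φ x     ≈⟨ ×-homo isGroupHomomorphism n x ⟨
        φ (n G.× x)   ≈⟨ ⟦⟧-cong xⁿ≈ε ⟩
        φ G.ε         ≈⟨ ε-homo ⟩
        H.ε           ∎)
      (λ uⁿ≈ε → injective (begin
        φ (n G.× x)   ≈⟨ ×-homo isGroupHomomorphism n x ⟩
        n H.× φ x     ≈⟨ H.×-congʳ n φx≈u ⟩
        n H.× u       ≈⟨ uⁿ≈ε ⟩
        H.ε           ≈⟨ ε-homo ⟨
        φ G.ε         ∎))

    equalOrderConjugate-transport : G.EqualOrderConjugate → H.EqualOrderConjugate
    equalOrderConjugate-transport conj {u} {v} u~v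
      with x , φx≈u ← preimage u | y , φy≈v ← preimage v
      with g , xᵍ≈y ← conj (λ n →
        ⇔-sym (annihilators-preserved φy≈v n) ⇔-∘ (u~v n ⇔-∘ annihilators-preserved φx≈u n)) =
      φ g , (begin
        u H.^ φ g    ≈⟨ H.^-cong φx≈u H.refl ⟨
        φ x H.^ φ g  ≈⟨ ^-homo isGroupHomomorphism x g ⟨
        φ (x G.^ g)  ≈⟨ ⟦⟧-cong xᵍ≈y ⟩
        φ y          ≈⟨ φy≈v ⟩
        v            ∎)

module _ {Γ : Group c ℓ} where
  open Elements Γ

  cyclicPartialAut : ∀ {u v} → SameOrder u v → FinitePartialAut Γ
  cyclicPartialAut {u} {v} u~v = record
    { n = 1
    ; m = 1
    ; a = const u
    ; b = const v
    ; p = relabel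
    ; isIso = record
      { isGroupMonomorphism = record
        { isGroupHomomorphism = record
          { isMonoidHomomorphism = record
            { isMagmaHomomorphism = record
              { isRelHomomorphism = record { cong = λ {x} {y} → relabel-cong {x} {y} }
              ; homo = λ _ _ → refl
              }
            ; ε-homo = refl
            }
          ; ⁻¹-homo = λ _ → refl
          }
        ; injective = λ {x} {y} → relabel-injective {x} {y}
        }
      ; surjective = λ { (_ , w , vʷ≈y) → (eval Γ (const u) w , w , refl) ,
                                          λ {z} z≈uʷ → trans (relabel-cong {z} {_ , w , refl} z≈uʷ) vʷ≈y }
      }
    }
    where
    ⟨u⟩ = Group.Carrier (span Γ (const u))
    ⟨v⟩ = Group.Carrier (span Γ (const v))

    relabel : ⟨u⟩ → ⟨v⟩
    relabel (_ , w , _) = eval Γ (const v) w , w , refl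

    relabel-cong : ∀ {x y : ⟨u⟩} → proj₁ x ≈ proj₁ y → proj₁ (relabel x) ≈ proj₁ (relabel y)
    relabel-cong {_ , w , uʷ≈x} {_ , w′ , uʷ′≈y} x≈y =
      eval-const-≈-transfer Γ Γ (λ n → Equivalence.to (u~v n)) {w = w} {w′}
        (trans uʷ≈x (trans x≈y (sym uʷ′≈y)))

    relabel-injective : ∀ {x y : ⟨u⟩} → proj₁ (relabel x) ≈ proj₁ (relabel y) → proj₁ x ≈ proj₁ y
    relabel-injective {_ , w , uʷ≈x} {_ , w′ , uʷ′≈y} vʷ≈vʷ′ =
      trans (sym uʷ≈x)
        (trans (eval-const-≈-transfer Γ Γ (λ n → Equivalence.from (u~v n)) {w = w} {w′} vʷ≈vʷ′) uʷ′≈y)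

  innerUltrahomogeneous⇒equalOrderConjugate : InnerUltrahomogeneous Γ → EqualOrderConjugate
  innerUltrahomogeneous⇒equalOrderConjugate iuh {u} u~v
    with g , conjugates ← iuh (cyclicPartialAut u~v) = g , conjugates (u , gen Fin.zero , refl)

×-swap-isGroupIsomorphism : (G₁ : Group c ℓ) (G₂ : Group c′ ℓ′) →
  GroupMorphisms.IsGroupIsomorphism (Group.rawGroup (DirectProduct.group G₁ G₂))
    (Group.rawGroup (DirectProduct.group G₂ G₁)) swap
×-swap-isGroupIsomorphism G₁ G₂ = record
  { isGroupMonomorphism = record
    { isGroupHomomorphism = record
      { isMonoidHomomorphism = record
        { isMagmaHomomorphism = record
          { isRelHomomorphism = record { cong = swap }
          ; homo = λ _ _ → refl
          }
        ; ε-homo = refl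
        }
      ; ⁻¹-homo = λ _ → refl
      }
    ; injective = swap
    }
  ; surjective = λ y → swap y , swap
  }
  where open Group (DirectProduct.group G₂ G₁) using (refl)

module _ (G₁ : Group c ℓ) (G₂ : Group c′ ℓ′) where
  private
    module G₁ = Elements G₁
    module G₂ = Elements G₂
    module P = Elements (DirectProduct.group G₁ G₂)

  ×-pair : ∀ n x → n P.× x P.≈ (n G₁.× proj₁ x , n G₂.× proj₂ x)
  ×-pair zero x = P.refl
  ×-pair (suc n) x = G₁.∙-congˡ (proj₁ (×-pair n x)) , G₂.∙-congˡ (proj₂ (×-pair n x))

  ×-pair≈ε : ∀ n {x₁ x₂} → n G₁.× x₁ G₁.≈ G₁.ε → n G₂.× x₂ G₂.≈ G₂.ε → n P.× (x₁ , x₂) P.≈ P.ε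
  ×-pair≈ε n x₁ⁿ≈ε x₂ⁿ≈ε = P.trans (×-pair n _) (x₁ⁿ≈ε , x₂ⁿ≈ε)

  ×-pair≈ε⇒proj₁ : ∀ n {x₁ x₂} → n P.× (x₁ , x₂) P.≈ P.ε → n G₁.× x₁ G₁.≈ G₁.ε
  ×-pair≈ε⇒proj₁ n xⁿ≈ε = proj₁ (P.trans (P.sym (×-pair n _)) xⁿ≈ε)

  order-divides⇒sameOrder : ∀ {s t} → (∀ n → n G₁.× s G₁.≈ G₁.ε → n G₂.× t G₂.≈ G₂.ε) →
    P.SameOrder (s , G₂.ε) (s , t)
  order-divides⇒sameOrder ann n = mk⇔
    (λ [s,ε]ⁿ≈ε → let sⁿ≈ε = ×-pair≈ε⇒proj₁ n [s,ε]ⁿ≈ε in ×-pair≈ε n sⁿ≈ε (ann n sⁿ≈ε))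
    (λ [s,t]ⁿ≈ε → ×-pair≈ε n (×-pair≈ε⇒proj₁ n [s,t]ⁿ≈ε) (G₂.×-ε n))

  module _ (conj : P.EqualOrderConjugate) where

    -- (s , 1) and (s , t) have the same order, but conjugation acts coordinatewise.
    ¬order-divides : ∀ {s t} → ¬ t G₂.≈ G₂.ε → ¬ (∀ n → n G₁.× s G₁.≈ G₁.ε → n G₂.× t G₂.≈ G₂.ε)
    ¬order-divides t≉ε ann with (_ , g₂) , (_ , ε^g₂≈t) ← conj (order-divides⇒sameOrder ann) =
      t≉ε (G₂.trans (G₂.sym ε^g₂≈t) (G₂.ε^g≈ε g₂))

    -- Every order divides that of h, which is infinite.
    first-factor-has-involution : Nontrivial G₁ → Nontrivial G₂ → ¬ ¬ G₁.HasInvolution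
    first-factor-has-involution (a , a≉ε) (b , b≉ε) noInvolution
      with (h , _) , (a^h≈a⁻¹ , _) ← P.conjugate-to-inverse conj (a , G₂.ε) =
      ¬order-divides b≉ε λ where
        zero _ → G₂.refl
        (suc n) hⁿ≈ε → ⊥-elim (1+n≢0 (G₁.inverter-infiniteOrder a^h≈a⁻¹ noInvolution a≉ε (suc n) hⁿ≈ε))

    ¬both-factors-have-involutions : G₁.HasInvolution → ¬ G₂.HasInvolution
    ¬both-factors-have-involutions (s , s-involution) (t , t-involution) =
      ¬order-divides nontrivial (involution-order-divides G₁ G₂ s-involution square≈ε)
      where open G₂.IsInvolution t-involution

proposition4p28 : {c ℓ c₁ ℓ₁ c₂ ℓ₂ : Level} (Γ : Group c ℓ) →
    InnerUltrahomogeneous Γ →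
    (G₁ : Group c₁ ℓ₁) (G₂ : Group c₂ ℓ₂) →
    Nontrivial G₁ → Nontrivial G₂ →
    ¬ IsoToProduct Γ G₁ G₂
proposition4p28 Γ iuh G₁ G₂ nontrivial₁ nontrivial₂ (_ , φ-iso) =
  first-factor-has-involution G₁ G₂ conj₁₂ nontrivial₁ nontrivial₂ λ involution₁ →
  first-factor-has-involution G₂ G₁ conj₂₁ nontrivial₂ nontrivial₁ λ involution₂ →
  ¬both-factors-have-involutions G₁ G₂ conj₁₂ involution₁ involution₂
  where
  G₁×G₂ = DirectProduct.group G₁ G₂
  G₂×G₁ = DirectProduct.group G₂ G₁

  conj₁₂ : Elements.EqualOrderConjugate G₁×G₂
  conj₁₂ = equalOrderConjugate-transport Γ G₁×G₂ φ-iso (innerUltrahomogeneous⇒equalOrderConjugate iuh)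

  conj₂₁ : Elements.EqualOrderConjugate G₂×G₁
  conj₂₁ = equalOrderConjugate-transport G₁×G₂ G₂×G₁ (×-swap-isGroupIsomorphism G₁ G₂) conj₁₂
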